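{- Let $Y$ and $Z$ be strings over an alphabet $\Sigma$. Then $Y$ is a subsequence of $Z$ if and only if $YY$ is a subsequence of $ZZ$.
   Context: A string $X$ is a subsequence of a string $S$ if there are indices $1\le i_1<\dots<i_{|X|}\le |S|$ with $X=S[i_1]S[i_2]\cdots S[i_{|X|}]$. $YY$ denotes the concatenation of $Y$ with itself. -}

module Defs where

{-# OPTIONS --safe #-}
module Submission where

open import Defs
open import Level using (Level)
open import Data.List using (List; _++_; []; _∷_)
open import Data.List.Relation.Binary.Sublist.Propositional
  using (_⊆_; _∷_; _∷ʳ_; ⊆-refl; ⊆-trans; minimum)
open import Data.List.Relation.Binary.Sublist.Propositional.Properties
  using (++⁺; ++⁺ˡ)
open import Data.Sum using (_⊎_; inj₁; inj₂; map₁; reduce)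
open import Function.Bundles using (_⇔_; mk⇔)

module _ {a : Level} {A : Set a} where

  -- If the embedding is still inside us when xs is used up, then xs ⊆ us;
  -- otherwise it has left us before reaching ys, so ys ⊆ vs.
  ++⊆++⇒⊆⊎⊆ : (xs ys us vs : List A) → xs ++ ys ⊆ us ++ vs → xs ⊆ us ⊎ ys ⊆ vs
  ++⊆++⇒⊆⊎⊆ xs       ys []       vs p          = inj₂ (⊆-trans (++⁺ˡ xs ⊆-refl) p)
  ++⊆++⇒⊆⊎⊆ []       ys (u ∷ us) vs p          = inj₁ (minimum (u ∷ us))
  ++⊆++⇒⊆⊎⊆ (x ∷ xs) ys (u ∷ us) vs (.u ∷ʳ p)  = map₁ (u ∷ʳ_) (++⊆++⇒⊆⊎⊆ (x ∷ xs) ys us vs p)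
  ++⊆++⇒⊆⊎⊆ (x ∷ xs) ys (u ∷ us) vs (x≡u ∷ p) = map₁ (x≡u ∷_) (++⊆++⇒⊆⊎⊆ xs ys us vs p)

lemma1 : ∀ {a : Level} {Σ : Set a} (Y Z : List Σ) → (Y ⊆ Z) ⇔ ((Y ++ Y) ⊆ (Z ++ Z))
lemma1 Y Z = mk⇔ (λ Y⊆Z → ++⁺ Y⊆Z Y⊆Z) (λ YY⊆ZZ → reduce (++⊆++⇒⊆⊎⊆ Y Y Z Z YY⊆ZZ))
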